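{- Let $k\ge2$ be an integer and let $M=(E,G)$ and $N=(D,G)$ be matroids with $M\in\mathcal E_k$. Then the twist doubling $M\triangle N$ of $M$ with respect to $N$ lies in $\mathcal E_k$ if and only if $N\in\mathcal E_{k-1}$.
   Context: A simple binary matroid (here just "matroid") is a pair $M=(E,G)$, where $G$ is identified with $\mathbb F_2^n\setminus\{0\}$ for some $n\ge0$ and $E\subseteq G$; $\dim(M)=n$. A flat of $G$ is a set $V\setminus\{0\}$ with $V$ a subspace, of dimension $\dim V$; a hyperplane is a flat of dimension $n-1$. For an integer $k$, $\mathcal E_k$ is the class of matroids $(E,G)$ with $|E\cap F|$ even for every flat $F$ of $G$ of dimension at least $k$. Twist doubling: given $M=(E,G)$ and $N=(D,G)$ on the same $G$, let $G'$ be a projective geometry (identified with $\mathbb F_2^{n+1}\setminus\{0\}$) having $G$ as a hyperplane, and $w\in G'\setminus G$; the twist doubling of $M$ by $w$ with respect to $N$ is $(E',G')$ with $E'=E\cup\{w+x: x\in E\,\triangle\, D\}$ ($\triangle$ = symmetric difference). It is determined up to isomorphism by $M$ and $N$. -}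

module Defs where

open import Data.Bool using (Bool; true; false; _xor_; _∧_; not; if_then_else_)
open import Data.Nat using (ℕ; zero; suc; _+_; _≤_)
open import Data.Nat.Divisibility using (_∣_)
open import Data.Vec using (Vec; []; _∷_; replicate; zipWith; foldr)
open import Data.List using (List; []; _∷_; _++_; map; length; filter)
open import Data.Product using (Σ; _×_; _,_; ∃-syntax)
open import Relation.Binary.PropositionalEquality using (_≡_)
open import Relation.Nullary using (¬_)
open import Relation.Nullary.Decidable using (Dec)
open import Data.Bool.Properties using (T?)
open import Data.Bool using (T)

-- Vectors of F₂ⁿ; F₂ is Bool with xor as addition and ∧ as multiplication.
Vector : ℕ → Set
Vector n = Vec Bool n

𝟘 : ∀ {n} → Vector n
𝟘 = replicate _ false

_⊕_ : ∀ {n} → Vector n → Vector n → Vector n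
_⊕_ = zipWith _xor_

_·_ : ∀ {n} → Bool → Vector n → Vector n
b · v = Data.Vec.map (b ∧_) v

nonzero : ∀ {n} → Vector n → Bool
nonzero [] = false
nonzero (b ∷ v) = if b then true else nonzero v

allVecs : (n : ℕ) → List (Vector n)
allVecs zero = [] ∷ []
allVecs (suc n) = map (false ∷_) (allVecs n) ++ map (true ∷_) (allVecs n)

count : ∀ {n} → (Vector n → Bool) → ℕ
count {n} P = length (filter (λ v → T? (P v)) (allVecs n))

-- A simple binary matroid (E, G) with G = F₂ⁿ ∖ {0}: E is a (decidable)
-- subset of F₂ⁿ not containing 0.
record Matroid (n : ℕ) : Set where
  field
    E      : Vector n → Bool
    E-zero : E 𝟘 ≡ false
open Matroid public

lincomb : ∀ {n d} → Vec Bool d → Vec (Vector n) d → Vector n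
lincomb [] [] = 𝟘
lincomb (c ∷ cs) (v ∷ vs) = (c · v) ⊕ lincomb cs vs

record IsSubspace {n : ℕ} (V : Vector n → Bool) : Set where
  field
    zero-mem : V 𝟘 ≡ true
    add-mem  : ∀ u v → V u ≡ true → V v ≡ true → V (u ⊕ v) ≡ true

record HasDim {n : ℕ} (V : Vector n → Bool) (d : ℕ) : Set where
  field
    basis       : Vec (Vector n) d
    independent : ∀ (c : Vec Bool d) → lincomb c basis ≡ 𝟘 → c ≡ replicate d false
    in-V        : ∀ (c : Vec Bool d) → V (lincomb c basis) ≡ true
    spans       : ∀ v → V v ≡ true → ∃[ c ] lincomb c basis ≡ v

-- |E ∩ F| for the flat F = V ∖ {0}
flatCount : ∀ {n} → Matroid n → (Vector n → Bool) → ℕ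
flatCount M V = count (λ v → E M v ∧ V v ∧ nonzero v)

InE : ℕ → ∀ {n} → Matroid n → Set
InE k {n} M = ∀ (V : Vector n → Bool) (d : ℕ) → IsSubspace V → HasDim V d → k ≤ d →
  2 ∣ flatCount M V

-- Twist doubling. G' = F₂ⁿ⁺¹ ∖ {0}, G is the hyperplane {first coordinate = 0}
-- (x ↦ false ∷ x), and w = true ∷ 0, so w + (false ∷ x) = true ∷ x.
-- E' = E ∪ { w + x : x ∈ E △ D }.
twistE : ∀ {n} → Matroid n → Matroid n → Vector (suc n) → Bool
twistE M N (false ∷ x) = E M x
twistE M N (true ∷ x)  = E M x xor E N x

twist : ∀ {n} → Matroid n → Matroid n → Matroid (suc n)
twist M N = record { E = twistE M N ; E-zero = E-zero M }

{-# OPTIONS --safe #-}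

-- Parities of |E ∩ F| are xor-sums over F₂ⁿ. Splitting G' = G ∪ (w + G), a flat V of G' meets the
-- twist doubling in (E ∩ P) ∪ (w + (E △ D) ∩ Q), where P = V ∩ G and w + Q = V ∖ G, so its parity is
-- |E ∩ P| + |E ∩ Q| + |D ∩ Q| mod 2. If w ∈ V then P = Q is a flat of dimension dim V − 1; if w ∉ V
-- then P ⊔ Q is a flat of dimension dim V and, unless Q = ∅, P has dimension dim V − 1. Either way the
-- first two terms cancel because M ∈ 𝓔ₖ and the last vanishes because N ∈ 𝓔ₖ₋₁. Conversely a flat W
-- of G of dimension d spans with w a flat of dimension d + 1 whose parity is that of |D ∩ W|.

module Submission where

open import Defs
open import Algebra.Bundles using (CommutativeRing)
open import Data.Bool using (Bool; true; false; _xor_; _∧_; _∨_; not)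
open import Data.Bool.Properties
  using ( T?; xor-same; xor-assoc; xor-comm; xor-identityˡ; xor-identityʳ; xor-∧-commutativeRing
        ; ∧-zeroʳ; ∧-identityʳ; ∧-distribʳ-xor; ∨-zeroʳ; not-involutive; ⇔→≡)
open import Data.Bool.Solver using (module xor-∧-Solver)
open import Data.List using (List; []; _∷_; _++_; map; length; filter)
open import Data.Nat using (ℕ; zero; suc; _*_; _≤_; _∸_; s≤s)
open import Data.Nat.Properties using (≤-trans; n≤1+n)
open import Data.Nat.Divisibility using (_∣_; divides; _∣0; ∣-refl; ∣m∣n⇒∣m+n)
open import Data.Product using (_×_; _,_; proj₁; proj₂; ∃-syntax)
open import Data.Sum using (_⊎_; inj₁; inj₂)
open import Data.Vec using (Vec; []; _∷_; replicate; head; tail)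
import Data.Vec as Vec
open import Data.Vec.Properties
  using (zipWith-comm; zipWith-identityˡ; map-const; ∷-injectiveˡ; ∷-injectiveʳ)
open import Function.Bundles using (_⇔_; mk⇔; Equivalence)
open import Relation.Binary.PropositionalEquality
open import Algebra.Properties.CommutativeSemigroup
  (CommutativeRing.+-commutativeSemigroup xor-∧-commutativeRing) using (interchange)

private
  variable
    k m n d : ℕ

xor≡false⇒≡ : ∀ x y → x xor y ≡ false → x ≡ y
xor≡false⇒≡ false false _ = refl
xor≡false⇒≡ true  true  _ = refl

∧-∨-disjoint : ∀ f p q → p ∧ q ≡ false → f ∧ (p ∨ q) ≡ (f ∧ p) xor (f ∧ q)
∧-∨-disjoint false p     q     _ = refl
∧-∨-disjoint true  false q     _ = refl
∧-∨-disjoint true  true  false _ = refl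

all-false⊎some-true : (f : Vector n → Bool) → (∀ x → f x ≡ false) ⊎ ∃[ x ] f x ≡ true
all-false⊎some-true {zero} f with f [] in e
... | false = inj₁ λ { [] → e }
... | true  = inj₂ ([] , e)
all-false⊎some-true {suc n} f
  with all-false⊎some-true (λ x → f (false ∷ x)) | all-false⊎some-true (λ x → f (true ∷ x))
... | inj₂ (x , e) | _            = inj₂ (false ∷ x , e)
... | inj₁ _       | inj₂ (x , e) = inj₂ (true ∷ x , e)
... | inj₁ e₀      | inj₁ e₁      = inj₁ λ { (false ∷ x) → e₀ x ; (true ∷ x) → e₁ x }

xorSum : {A : Set} → (A → Bool) → List A → Bool
xorSum f []       = false
xorSum f (x ∷ xs) = f x xor xorSum f xs

module _ {A : Set} where

  xorSum-++ : (f : A → Bool) (xs ys : List A) →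
    xorSum f (xs ++ ys) ≡ xorSum f xs xor xorSum f ys
  xorSum-++ f []       ys = refl
  xorSum-++ f (x ∷ xs) ys = trans (cong (f x xor_) (xorSum-++ f xs ys)) (sym (xor-assoc (f x) _ _))

  xorSum-map : {B : Set} (f : B → Bool) (g : A → B) (xs : List A) →
    xorSum f (map g xs) ≡ xorSum (λ x → f (g x)) xs
  xorSum-map f g []       = refl
  xorSum-map f g (x ∷ xs) = cong (f (g x) xor_) (xorSum-map f g xs)

  xorSum-cong : {f g : A → Bool} → (∀ x → f x ≡ g x) → (xs : List A) → xorSum f xs ≡ xorSum g xs
  xorSum-cong f≗g []       = refl
  xorSum-cong f≗g (x ∷ xs) = cong₂ _xor_ (f≗g x) (xorSum-cong f≗g xs)

  xorSum-xor : (f g : A → Bool) (xs : List A) →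
    xorSum (λ x → f x xor g x) xs ≡ xorSum f xs xor xorSum g xs
  xorSum-xor f g []       = refl
  xorSum-xor f g (x ∷ xs) = trans (cong ((f x xor g x) xor_) (xorSum-xor f g xs))
    (interchange (f x) (g x) (xorSum f xs) (xorSum g xs))

  xorSum-false : (xs : List A) → xorSum (λ _ → false) xs ≡ false
  xorSum-false []       = refl
  xorSum-false (x ∷ xs) = xorSum-false xs

odd : ℕ → Bool
odd zero    = false
odd (suc m) = not (odd m)

odd-length-filter : {A : Set} (f : A → Bool) (xs : List A) →
  odd (length (filter (λ x → T? (f x)) xs)) ≡ xorSum f xs
odd-length-filter f []       = refl
odd-length-filter f (x ∷ xs) with f x
... | true  = cong not (odd-length-filter f xs)
... | false = odd-length-filter f xs

2∣⇔odd≡false : ∀ m → 2 ∣ m ⇔ odd m ≡ false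
2∣⇔odd≡false m = mk⇔ (λ { (divides q refl) → odd-*2 q }) (odd≡false⇒2∣ m)
  where
  odd-*2 : ∀ q → odd (q * 2) ≡ false
  odd-*2 zero    = refl
  odd-*2 (suc q) = trans (not-involutive (odd (q * 2))) (odd-*2 q)
  odd≡false⇒2∣ : ∀ m → odd m ≡ false → 2 ∣ m
  odd≡false⇒2∣ zero          _ = 2 ∣0
  odd≡false⇒2∣ (suc (suc m)) h =
    ∣m∣n⇒∣m+n ∣-refl (odd≡false⇒2∣ m (trans (sym (not-involutive (odd m))) h))

parity : (Vector n → Bool) → Bool
parity {n} f = xorSum f (allVecs n)

parity-on : (Vector n → Bool) → (Vector n → Bool) → Bool
parity-on F V = parity (λ x → F x ∧ V x)

parity-cong : {f g : Vector n → Bool} → (∀ x → f x ≡ g x) → parity f ≡ parity g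
parity-cong {n} f≗g = xorSum-cong f≗g (allVecs n)

parity-xor : (f g : Vector n → Bool) → parity (λ x → f x xor g x) ≡ parity f xor parity g
parity-xor {n} f g = xorSum-xor f g (allVecs n)

parity-false : parity {n} (λ _ → false) ≡ false
parity-false {n} = xorSum-false (allVecs n)

parity-split : (f : Vector (suc n) → Bool) →
  parity f ≡ parity (λ x → f (false ∷ x)) xor parity (λ x → f (true ∷ x))
parity-split {n} f = trans (xorSum-++ f (map (false ∷_) (allVecs n)) _)
  (cong₂ _xor_ (xorSum-map f (false ∷_) (allVecs n)) (xorSum-map f (true ∷_) (allVecs n)))

count-even⇔ : (f : Vector n → Bool) → 2 ∣ count f ⇔ parity f ≡ false
count-even⇔ {n} f = subst (λ b → 2 ∣ count f ⇔ b ≡ false)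
  (odd-length-filter f (allVecs n)) (2∣⇔odd≡false (count f))

nonzero≡false⇒≡𝟘 : (v : Vector n) → nonzero v ≡ false → v ≡ 𝟘
nonzero≡false⇒≡𝟘 []          _ = refl
nonzero≡false⇒≡𝟘 (false ∷ v) h = cong (false ∷_) (nonzero≡false⇒≡𝟘 v h)

flatCount-even⇔ : (M : Matroid n) (V : Vector n → Bool) →
  2 ∣ flatCount M V ⇔ parity-on (E M) V ≡ false
flatCount-even⇔ M V = subst (λ b → 2 ∣ flatCount M V ⇔ b ≡ false)
  (parity-cong E∧V∧nonzero) (count-even⇔ (λ v → E M v ∧ V v ∧ nonzero v))
  where
  E∧V∧nonzero : ∀ v → E M v ∧ V v ∧ nonzero v ≡ E M v ∧ V v
  E∧V∧nonzero v with nonzero v in nz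
  ... | true  = cong (E M v ∧_) (∧-identityʳ (V v))
  ... | false rewrite nonzero≡false⇒≡𝟘 v nz | E-zero M = refl

even-on-flat : (M : Matroid n) → InE k M → {V : Vector n → Bool} →
  IsSubspace V → HasDim V d → k ≤ d → parity-on (E M) V ≡ false
even-on-flat M even {V} sub dim k≤d =
  Equivalence.to (flatCount-even⇔ M V) (even V _ sub dim k≤d)


⊕-comm : (u v : Vector n) → u ⊕ v ≡ v ⊕ u
⊕-comm = zipWith-comm xor-comm

⊕-identityˡ : (u : Vector n) → 𝟘 ⊕ u ≡ u
⊕-identityˡ = zipWith-identityˡ xor-identityˡ

⊕-self : (u : Vector n) → u ⊕ u ≡ 𝟘
⊕-self []      = refl
⊕-self (x ∷ u) = cong₂ _∷_ (xor-same x) (⊕-self u)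

·-zeroʳ : ∀ a → a · 𝟘 {n} ≡ 𝟘
·-zeroʳ {zero}  a = refl
·-zeroʳ {suc n} a = cong₂ _∷_ (∧-zeroʳ a) (·-zeroʳ a)

head-⊕ : (u v : Vector (suc n)) → head (u ⊕ v) ≡ head u xor head v
head-⊕ (x ∷ u) (y ∷ v) = refl

record IsLinear (f : Vector m → Vector n) : Set where
  field
    map-𝟘    : f 𝟘 ≡ 𝟘
    map-comb : ∀ a u v → f ((a · u) ⊕ v) ≡ (a · f u) ⊕ f v

lincomb-map : {f : Vector m → Vector n} → IsLinear f →
  (c : Vec Bool d) (us : Vec (Vector m) d) → lincomb c (Vec.map f us) ≡ f (lincomb c us)
lincomb-map lin []      []       = sym (IsLinear.map-𝟘 lin)
lincomb-map lin (a ∷ c) (u ∷ us) =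
  trans (cong (_ ⊕_) (lincomb-map lin c us)) (sym (IsLinear.map-comb lin a u (lincomb c us)))

tail-linear : IsLinear (tail {n = n})
tail-linear = record { map-𝟘 = refl ; map-comb = λ { a (x ∷ u) (y ∷ v) → refl } }

false∷-linear : IsLinear {n} (false ∷_)
false∷-linear = record
  { map-𝟘    = refl
  ; map-comb = λ a u v →
      cong (_∷ ((a · u) ⊕ v)) (sym (trans (xor-identityʳ (a ∧ false)) (∧-zeroʳ a)))
  }

-- Gaussian elimination of the head coordinate against the pivot true ∷ t.
clearHead : Vector n → Vector (suc n) → Vector n
clearHead t u = tail u ⊕ (head u · t)

clearHead-spec : (t : Vector n) (u : Vector (suc n)) →
  (head u · (true ∷ t)) ⊕ u ≡ false ∷ clearHead t u
clearHead-spec t (x ∷ u) =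
  cong₂ _∷_ (trans (cong (_xor x) (∧-identityʳ x)) (xor-same x)) (⊕-comm (x · t) u)

clearHead-linear : (t : Vector n) → IsLinear (clearHead t)
clearHead-linear t = record
  { map-𝟘    = trans (cong (𝟘 ⊕_) (map-const t false)) (⊕-identityˡ 𝟘)
  ; map-comb = λ { a (x ∷ u) (y ∷ v) → combination a x y u v t }
  }
  where
  open xor-∧-Solver
  combination : ∀ {n} a x y (u v t : Vector n) →
    ((a · u) ⊕ v) ⊕ (((a ∧ x) xor y) · t) ≡ (a · (u ⊕ (x · t))) ⊕ (v ⊕ (y · t))
  combination a x y []      []      []      = refl
  combination a x y (p ∷ u) (q ∷ v) (r ∷ t) = cong₂ _∷_
    (solve 6 (λ a x y p q r → ((a :* p) :+ q) :+ (((a :* x) :+ y) :* r)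
                            := (a :* (p :+ (x :* r))) :+ (q :+ (y :* r))) refl a x y p q r)
    (combination a x y u v t)

-- A predicate V on G' = F₂ⁿ⁺¹ is cut by the hyperplane G = {head = false} into its section V ∩ G and
-- its coset V ∩ (w + G) translated back by w = true ∷ 𝟘; the shadow is the projection of V to G along w.
section coset shadow : (Vector (suc n) → Bool) → Vector n → Bool
section V x = V (false ∷ x)
coset   V x = V (true ∷ x)
shadow  V x = section V x ∨ coset V x

cylinder : (Vector n → Bool) → Vector (suc n) → Bool
cylinder W v = W (tail v)

module _ {V : Vector (suc n) → Bool} where

  shadow-intro : ∀ b x → V (b ∷ x) ≡ true → shadow V x ≡ true
  shadow-intro false x h = cong (_∨ coset V x) h
  shadow-intro true  x h = trans (cong (section V x ∨_) h) (∨-zeroʳ (section V x))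

  shadow-elim : ∀ x → shadow V x ≡ true → ∃[ b ] V (b ∷ x) ≡ true
  shadow-elim x h with section V x in e
  ... | true  = false , e
  ... | false = true , h

  section-isSubspace : IsSubspace V → IsSubspace (section V)
  section-isSubspace sub = record
    { zero-mem = zero-mem
    ; add-mem  = λ u v → add-mem (false ∷ u) (false ∷ v)
    }
    where open IsSubspace sub

  shadow-isSubspace : IsSubspace V → IsSubspace (shadow V)
  shadow-isSubspace sub = record
    { zero-mem = shadow-intro false 𝟘 zero-mem
    ; add-mem  = λ u v hu hv →
        let (a , ha) = shadow-elim u hu ; (b , hb) = shadow-elim v hv
        in shadow-intro (a xor b) (u ⊕ v) (add-mem (a ∷ u) (b ∷ v) ha hb)
    }
    where open IsSubspace sub

  coset≡section : IsSubspace V → V (true ∷ 𝟘) ≡ true → ∀ x → coset V x ≡ section V x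
  coset≡section sub w∈V x = ⇔→≡ (mk⇔ flip-head flip-head)
    where
    flip-head : ∀ {b} → V (b ∷ x) ≡ true → V (not b ∷ x) ≡ true
    flip-head {b} h = subst (λ u → V (not b ∷ u) ≡ true) (⊕-identityˡ x)
      (IsSubspace.add-mem sub (true ∷ 𝟘) (b ∷ x) w∈V h)

  section∧coset≡false : IsSubspace V → V (true ∷ 𝟘) ≡ false →
    ∀ x → section V x ∧ coset V x ≡ false
  section∧coset≡false sub w∉V x with section V x in e₀ | coset V x in e₁
  ... | false | _     = refl
  ... | true  | false = refl
  ... | true  | true  with () ← trans (sym (subst (λ u → V (true ∷ u) ≡ true) (⊕-self x)
                                  (IsSubspace.add-mem sub (false ∷ x) (true ∷ x) e₀ e₁))) w∉V

cylinder-isSubspace : {W : Vector n → Bool} → IsSubspace W → IsSubspace (cylinder W)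
cylinder-isSubspace sub = record
  { zero-mem = zero-mem
  ; add-mem  = λ { (a ∷ u) (b ∷ v) → add-mem u v }
  }
  where open IsSubspace sub

lincomb-cylinderBasis : ∀ a (c : Vec Bool d) (us : Vec (Vector n) d) →
  lincomb (a ∷ c) ((true ∷ 𝟘) ∷ Vec.map (false ∷_) us) ≡ a ∷ lincomb c us
lincomb-cylinderBasis a c us = begin
  (a · (true ∷ 𝟘)) ⊕ lincomb c (Vec.map (false ∷_) us)
    ≡⟨ cong ((a · (true ∷ 𝟘)) ⊕_) (lincomb-map false∷-linear c us) ⟩
  (a · (true ∷ 𝟘)) ⊕ (false ∷ lincomb c us)
    ≡⟨ cong₂ _∷_ (trans (xor-identityʳ (a ∧ true)) (∧-identityʳ a))
                 (trans (cong (_⊕ lincomb c us) (·-zeroʳ a)) (⊕-identityˡ (lincomb c us))) ⟩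
  a ∷ lincomb c us ∎
  where open ≡-Reasoning

cylinder-hasDim : {W : Vector n → Bool} → HasDim W d → HasDim (cylinder W) (suc d)
cylinder-hasDim {W = W} dim = record
  { basis       = (true ∷ 𝟘) ∷ Vec.map (false ∷_) basis
  ; independent = λ { (a ∷ c) eq →
      let eq′ = trans (sym (lincomb-cylinderBasis a c basis)) eq
      in cong₂ _∷_ (∷-injectiveˡ eq′) (independent c (∷-injectiveʳ eq′)) }
  ; in-V        = λ { (a ∷ c) →
      subst (λ v → cylinder W v ≡ true) (sym (lincomb-cylinderBasis a c basis)) (in-V c) }
  ; spans       = λ { (b ∷ x) hx → let (c , e) = spans x hx
      in b ∷ c , trans (lincomb-cylinderBasis b c basis) (cong (b ∷_) e) }
  }
  where open HasDim dim

shadow-hasDim : {V : Vector (suc n) → Bool} → HasDim V d → V (true ∷ 𝟘) ≡ false →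
  HasDim (shadow V) d
shadow-hasDim {V = V} dim w∉V = record
  { basis       = Vec.map tail basis
  ; independent = λ c eq →
      independent c (tail≡𝟘⇒≡𝟘 (lincomb c basis) (in-V c) (trans (sym (lincomb-tail c)) eq))
  ; in-V        = λ c →
      subst (λ x → shadow V x ≡ true) (sym (lincomb-tail c))
        (shadow-tail (lincomb c basis) (in-V c))
  ; spans       = λ x hx → let (b , hb) = shadow-elim {V = V} x hx ; (c , e) = spans (b ∷ x) hb
      in c , trans (lincomb-tail c) (cong tail e)
  }
  where
  open HasDim dim
  lincomb-tail : ∀ c → lincomb c (Vec.map tail basis) ≡ tail (lincomb c basis)
  lincomb-tail c = lincomb-map tail-linear c basis
  shadow-tail : ∀ v → V v ≡ true → shadow V (tail v) ≡ true
  shadow-tail (b ∷ x) = shadow-intro {V = V} b x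
  tail≡𝟘⇒≡𝟘 : ∀ v → V v ≡ true → tail v ≡ 𝟘 → v ≡ 𝟘
  tail≡𝟘⇒≡𝟘 (false ∷ x) _   eq = cong (false ∷_) eq
  tail≡𝟘⇒≡𝟘 (true ∷ x)  v∈V eq
    with () ← trans (sym v∈V) (trans (cong (λ u → V (true ∷ u)) eq) w∉V)

-- A basis of the subspace of coefficient vectors c with head (lincomb c us) ≡ false,
-- given as an injective parametrisation by F₂ᵐ; built by pivoting on the first vector of us
-- whose head is true.
record HeadKernel (us : Vec (Vector (suc n)) (suc m)) : Set where
  field
    basis          : Vec (Vector n) m
    embed          : Vec Bool m → Vec Bool (suc m)
    restrict       : Vec Bool (suc m) → Vec Bool m
    lincomb-embed  : ∀ c → lincomb (embed c) us ≡ false ∷ lincomb c basis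
    embed-zero     : ∀ c → embed c ≡ replicate _ false → c ≡ replicate _ false
    embed-restrict : ∀ c → head (lincomb c us) ≡ false → embed (restrict c) ≡ c

head-lincomb-false∷ : ∀ a (t : Vector n) (c : Vec Bool d) us →
  head (lincomb (a ∷ c) ((false ∷ t) ∷ us)) ≡ head (lincomb c us)
head-lincomb-false∷ a t c us =
  trans (head-⊕ (a · (false ∷ t)) (lincomb c us)) (cong (_xor head (lincomb c us)) (∧-zeroʳ a))

headKernel : (us : Vec (Vector (suc n)) (suc m)) (c₀ : Vec Bool (suc m)) →
  head (lincomb c₀ us) ≡ true → HeadKernel us
headKernel ((true ∷ t) ∷ us) _ _ = record
  { basis          = Vec.map (clearHead t) us
  ; embed          = λ c → head (lincomb c us) ∷ c
  ; restrict       = tail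
  ; lincomb-embed  = λ c → trans (clearHead-spec t (lincomb c us))
                             (cong (false ∷_) (sym (lincomb-map (clearHead-linear t) c us)))
  ; embed-zero     = λ c → ∷-injectiveʳ
  ; embed-restrict = λ { (a ∷ c) eq → cong (_∷ c) (trans
      (sym (xor≡false⇒≡ (a ∧ true) _ (trans (sym (head-⊕ (a · (true ∷ t)) (lincomb c us))) eq)))
      (∧-identityʳ a)) }
  }
headKernel ((false ∷ t) ∷ []) (a ∷ []) h₀ with () ← trans (sym h₀) (head-lincomb-false∷ a t [] [])
headKernel ((false ∷ t) ∷ us@(_ ∷ _)) (a₀ ∷ c₀) h₀ = record
  { basis          = t ∷ K.basis
  ; embed          = λ { (a ∷ c) → a ∷ K.embed c }
  ; restrict       = λ { (a ∷ c) → a ∷ K.restrict c }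
  ; lincomb-embed  = λ { (a ∷ c) → trans (cong ((a · (false ∷ t)) ⊕_) (K.lincomb-embed c))
                                     (sym (IsLinear.map-comb false∷-linear a t (lincomb c K.basis))) }
  ; embed-zero     = λ { (a ∷ c) eq →
      cong₂ _∷_ (∷-injectiveˡ eq) (K.embed-zero c (∷-injectiveʳ eq)) }
  ; embed-restrict = λ { (a ∷ c) eq →
      cong (a ∷_) (K.embed-restrict c (trans (sym (head-lincomb-false∷ a t c us)) eq)) }
  }
  where
  module K = HeadKernel (headKernel us c₀ (trans (sym (head-lincomb-false∷ a₀ t c₀ us)) h₀))

section-hasDim : {V : Vector (suc n) → Bool} → HasDim V (suc m) → ∀ {y} → coset V y ≡ true →
  HasDim (section V) m
section-hasDim {V = V} dim {y} y∈coset = record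
  { basis       = K.basis
  ; independent = λ c eq →
      K.embed-zero c (independent (K.embed c) (trans (K.lincomb-embed c) (cong (false ∷_) eq)))
  ; in-V        = λ c → subst (λ v → V v ≡ true) (K.lincomb-embed c) (in-V (K.embed c))
  ; spans       = λ x hx → let (c , e) = spans (false ∷ x) hx in K.restrict c , cong tail (begin
      false ∷ lincomb (K.restrict c) K.basis ≡⟨ sym (K.lincomb-embed (K.restrict c)) ⟩
      lincomb (K.embed (K.restrict c)) basis
        ≡⟨ cong (λ c′ → lincomb c′ basis) (K.embed-restrict c (cong head e)) ⟩
      lincomb c basis                        ≡⟨ e ⟩
      false ∷ x                              ∎)
  }
  where
  open HasDim dim
  open ≡-Reasoning
  y∈span = spans (true ∷ y) y∈coset
  module K = HeadKernel (headKernel basis (proj₁ y∈span) (cong head (proj₂ y∈span)))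

parity-twist : (M N : Matroid n) (V : Vector (suc n) → Bool) →
  parity-on (twistE M N) V
    ≡ (parity-on (E M) (section V) xor parity-on (E M) (coset V)) xor parity-on (E N) (coset V)
parity-twist M N V = begin
  parity-on (twistE M N) V
    ≡⟨ parity-split (λ v → twistE M N v ∧ V v) ⟩
  parity-on (E M) (section V) xor parity (λ x → (E M x xor E N x) ∧ coset V x)
    ≡⟨ cong (parity-on (E M) (section V) xor_)
         (trans (parity-cong (λ x → ∧-distribʳ-xor (coset V x) (E M x) (E N x)))
                (parity-xor (λ x → E M x ∧ coset V x) (λ x → E N x ∧ coset V x))) ⟩
  parity-on (E M) (section V) xor (parity-on (E M) (coset V) xor parity-on (E N) (coset V))
    ≡⟨ sym (xor-assoc (parity-on (E M) (section V)) _ _) ⟩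
  (parity-on (E M) (section V) xor parity-on (E M) (coset V)) xor parity-on (E N) (coset V) ∎
  where open ≡-Reasoning

parity-shadow : {V : Vector (suc n) → Bool} → IsSubspace V → V (true ∷ 𝟘) ≡ false →
  (F : Vector n → Bool) → parity-on F (shadow V) ≡ parity-on F (section V) xor parity-on F (coset V)
parity-shadow {V = V} sub w∉V F = trans
  (parity-cong (λ x →
    ∧-∨-disjoint (F x) (section V x) (coset V x) (section∧coset≡false sub w∉V x)))
  (parity-xor (λ x → F x ∧ section V x) (λ x → F x ∧ coset V x))

section-xor-coset-even : (M : Matroid n) → InE k M → {V : Vector (suc n) → Bool} →
  IsSubspace V → HasDim V d → k ≤ d →
  parity-on (E M) (section V) xor parity-on (E M) (coset V) ≡ false
section-xor-coset-even M even {V} sub dim k≤d with V (true ∷ 𝟘) in w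
... | true  = trans (cong (parity-on (E M) (section V) xor_)
                      (parity-cong (λ x → cong (E M x ∧_) (coset≡section sub w x))))
                    (xor-same (parity-on (E M) (section V)))
... | false = trans (sym (parity-shadow sub w (E M)))
                    (even-on-flat M even (shadow-isSubspace sub) (shadow-hasDim dim w) k≤d)

coset-even : (N : Matroid n) → InE k N → {V : Vector (suc n) → Bool} →
  IsSubspace V → HasDim V (suc m) → k ≤ m → parity-on (E N) (coset V) ≡ false
coset-even {n = n} N even {V} sub dim k≤m with V (true ∷ 𝟘) in w
... | true  = trans (parity-cong (λ x → cong (E N x ∧_) (coset≡section sub w x)))
                    (even-on-flat N even (section-isSubspace sub) (section-hasDim dim w) k≤m)
... | false with all-false⊎some-true (coset V)
...   | inj₁ empty = trans
  (parity-cong (λ x → trans (cong (E N x ∧_) (empty x)) (∧-zeroʳ (E N x)))) (parity-false {n})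
...   | inj₂ (y , y∈coset) = begin
  parity-on (E N) (coset V)
    ≡⟨ cong (_xor parity-on (E N) (coset V)) (sym (even-on-flat N even
         (section-isSubspace sub) (section-hasDim dim y∈coset) k≤m)) ⟩
  parity-on (E N) (section V) xor parity-on (E N) (coset V)
    ≡⟨ sym (parity-shadow sub w (E N)) ⟩
  parity-on (E N) (shadow V)
    ≡⟨ even-on-flat N even (shadow-isSubspace sub) (shadow-hasDim dim w) (≤-trans k≤m (n≤1+n _)) ⟩
  false ∎
  where open ≡-Reasoning

InE-twist⇒InE : (M N : Matroid n) → InE (suc k) (twist M N) → InE k N
InE-twist⇒InE M N even W d sub dim k≤d = Equivalence.from (flatCount-even⇔ N W) (begin
  parity-on (E N) W
    ≡⟨ cong (_xor parity-on (E N) W) (sym (xor-same (parity-on (E M) W))) ⟩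
  (parity-on (E M) W xor parity-on (E M) W) xor parity-on (E N) W
    ≡⟨ sym (parity-twist M N (cylinder W)) ⟩
  parity-on (twistE M N) (cylinder W)
    ≡⟨ even-on-flat (twist M N) even (cylinder-isSubspace sub) (cylinder-hasDim dim) (s≤s k≤d) ⟩
  false ∎)
  where open ≡-Reasoning

InE⇒InE-twist : (M N : Matroid n) → InE (suc k) M → InE k N → InE (suc k) (twist M N)
InE⇒InE-twist M N evenM evenN V (suc m) sub dim (s≤s k≤m) =
  Equivalence.from (flatCount-even⇔ (twist M N) V) (begin
    parity-on (twistE M N) V
      ≡⟨ parity-twist M N V ⟩
    (parity-on (E M) (section V) xor parity-on (E M) (coset V)) xor parity-on (E N) (coset V)
      ≡⟨ cong₂ _xor_ (section-xor-coset-even M evenM sub dim (s≤s k≤m))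
                     (coset-even N evenN sub dim k≤m) ⟩
    false ∎)
  where open ≡-Reasoning

lemma3p1 : ∀ {n : ℕ} (k : ℕ) → 2 ≤ k → (M N : Matroid n) → InE k M →
    (InE k (twist M N) → InE (k ∸ 1) N) × (InE (k ∸ 1) N → InE k (twist M N))
lemma3p1 (suc k) _ M N evenM = InE-twist⇒InE M N , InE⇒InE-twist M N evenM
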